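{- Let $q\ge2$ be a power of a prime. For $j,m,n\in\mathbb{N}^*$ with $n\geq q^j+1$ and $m\geq q^j$, $b_{j+1,m,n}$ is defined if and only if $b_{j,m-q^j+1,n-q^j}$ is defined, and when they are defined, $b_{j+1,m,n}=b_{j,m-q^j+1,n-q^j}$.
   Context: For a word $w$ over $\{0,\dots,q-1\}$, $[w]_q$ is the integer whose base-$q$ expansion is $w$, and $x^m$ denotes $m$ copies of the letter $x$ (so $[1^00]_q=0$). Decomposition procedure: given a positive integer $b$, set $b_1=b$. Inductively, if $b_i$ has been defined and $b_i\ge q-1$, let $l_i=\max\{l\in\mathbb{N}^*: b_i\geq q^l-1\}$; if $b_i-(q^{l_i}-1)>[1^{l_i-1}0]_q$ the procedure stops, otherwise set $b_{i+1}=b_i-(q^{l_i}-1)$ and continue. If $b_i<q-1$ the procedure stops. For $j,m\in\mathbb{N}^*$, $b_{j,m,n}$ denotes the term $b_n$ produced by this procedure with input $b_1=[1^m0^j]_q$ (undefined if the procedure stops before producing $b_n$). -}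

module Defs where

open import Data.Nat using (ℕ; zero; suc; _+_; _*_; _∸_; _^_; _≤_; _<_; _≥_)
open import Data.Nat.Primality using (Prime)
open import Data.Product using (Σ; _×_; ∃)
open import Relation.Binary.PropositionalEquality using (_≡_)

IsPrimePower : ℕ → Set
IsPrimePower q = Σ ℕ λ p → Σ ℕ λ k → Prime p × 1 ≤ k × q ≡ p ^ k

ones : ℕ → ℕ → ℕ
ones q zero    = 0
ones q (suc m) = ones q m * q + 1

-- [1^m 0^j]_q
word : ℕ → ℕ → ℕ → ℕ
word q m j = ones q m * q ^ j

IsMaxL : ℕ → ℕ → ℕ → Set
IsMaxL q b l = 1 ≤ l × q ^ l ∸ 1 ≤ b × b < q ^ suc l ∸ 1

-- One step of the decomposition procedure: from b_i the procedure continues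
-- and produces b_{i+1} = b'.
data Step (q b : ℕ) : ℕ → Set where
  step : (l : ℕ) → q ∸ 1 ≤ b → IsMaxL q b l →
         b ∸ (q ^ l ∸ 1) ≤ word q (l ∸ 1) 1 →
         Step q b (b ∸ (q ^ l ∸ 1))

-- Term q b n v : the procedure started at b_1 = b produces b_n = v.
data Term (q b : ℕ) : ℕ → ℕ → Set where
  first : Term q b 1 b
  next  : ∀ {n x y} → Term q b n x → Step q x y → Term q b (suc n) y

-- b_{j,m,n} is defined and equals v
B : ℕ → ℕ → ℕ → ℕ → ℕ → Set
B q j m n v = Term q (word q m j) n v

Defined : ℕ → ℕ → ℕ → ℕ → Set
Defined q j m n = ∃ λ v → B q j m n v

-- Write P = q^(j+1).  For t < q^j the decomposition procedure sends
-- [1^(k+1)]_q * P + t to [1^k]_q * P + (t + 1): the maximal l is k + 1 + j,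
-- and subtracting q^l - 1 removes the leading 1 and carries one unit into the
-- low digits.  Starting from [1^m 0^(j+1)]_q = [1^m]_q * P and iterating q^j
-- times reaches [1^(m-q^j)]_q * P + q^j = [1^(m-q^j+1) 0^j]_q.  Since the
-- procedure is deterministic, the run from [1^m 0^(j+1)]_q is, after these q^j
-- steps, the run from [1^(m-q^j+1) 0^j]_q.
module Submission where

open import Defs
open import Data.Nat using (ℕ; zero; suc; _+_; _*_; _∸_; _^_; _≤_; _<_; _≥_; z≤n; s≤s; NonZero; >-nonZero)
open import Data.Nat.Properties
open import Data.Nat.Solver using (module +-*-Solver)
open import Data.Product using (_×_; _,_; map₂)
open import Function.Bundles using (_⇔_; mk⇔; Equivalence)
open import Relation.Binary.PropositionalEquality
open +-*-Solver

module Decomposition (q : ℕ) .{{_ : NonZero q}} where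

  IsMaxL-≤ : ∀ {b l l′} → IsMaxL q b l → IsMaxL q b l′ → l ≤ l′
  IsMaxL-≤ (_ , q^l∸1≤b , _) (_ , _ , b<q^l′⁺∸1) = ≮⇒≥ λ l′<l →
    <⇒≱ b<q^l′⁺∸1 (≤-trans (∸-monoˡ-≤ 1 (^-monoʳ-≤ q l′<l)) q^l∸1≤b)

  IsMaxL-unique : ∀ {b l l′} → IsMaxL q b l → IsMaxL q b l′ → l ≡ l′
  IsMaxL-unique p p′ = ≤-antisym (IsMaxL-≤ p p′) (IsMaxL-≤ p′ p)

  Step-deterministic : ∀ {b c c′} → Step q b c → Step q b c′ → c ≡ c′
  Step-deterministic {b} (step _ _ p _) (step _ _ p′ _) =
    cong (λ l → b ∸ (q ^ l ∸ 1)) (IsMaxL-unique p p′)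

  step-to : ∀ {b c} l → q ∸ 1 ≤ b → IsMaxL q b l → b ≡ (q ^ l ∸ 1) + c →
            c ≤ word q (l ∸ 1) 1 → Step q b c
  step-to {b} {c} l q∸1≤b max b≡ c≤ =
    subst (Step q b) next≡c (step l q∸1≤b max (subst (_≤ word q (l ∸ 1) 1) (sym next≡c) c≤))
    where
    next≡c : b ∸ (q ^ l ∸ 1) ≡ c
    next≡c = trans (cong (_∸ (q ^ l ∸ 1)) b≡) (m+n∸m≡n (q ^ l ∸ 1) c)

  Term-deterministic : ∀ {b n v w} → Term q b n v → Term q b n w → v ≡ w
  Term-deterministic first         first           = refl
  Term-deterministic first         (next () _)
  Term-deterministic (next () _)   first
  Term-deterministic (next t s)    (next t′ s′)
    with refl ← Term-deterministic t t′ = Step-deterministic s s′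

  Term-++ : ∀ {b k x d v} → Term q b (suc k) x → Term q x (suc d) v → Term q b (suc (d + k)) v
  Term-++ p first                = p
  Term-++ p (next {zero} () _)
  Term-++ p (next {suc _} t s)   = next (Term-++ p t) s

  Term-dropPrefix : ∀ {b k x} d {v} → Term q b (suc k) x → Term q b (suc (d + k)) v → Term q x (suc d) v
  Term-dropPrefix zero    p t with refl ← Term-deterministic p t = first
  Term-dropPrefix (suc d) p (next t s) = next (Term-dropPrefix d p t) s

  Term-drop : ∀ {b k x n v} → Term q b (suc k) x → k < n → Term q b n v ⇔ Term q x (n ∸ k) v
  Term-drop {b} {k} {x} {suc n} {v} p (s≤s k≤n) =
    subst₂ (λ i i′ → Term q b i v ⇔ Term q x i′ v) length-≡ remaining-≡
      (mk⇔ (Term-dropPrefix (n ∸ k) p) (Term-++ p))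
    where
    length-≡ : suc (n ∸ k + k) ≡ suc n
    length-≡ = cong suc (m∸n+n≡m k≤n)
    remaining-≡ : suc (n ∸ k) ≡ suc n ∸ k
    remaining-≡ = sym (+-∸-assoc 1 k≤n)

module Carry (q : ℕ) (2≤q : 2 ≤ q) where

  private instance
    q≢0 : NonZero q
    q≢0 = >-nonZero (≤-trans (s≤s z≤n) 2≤q)

  open Decomposition q {{q≢0}} public

  ones-suc : ∀ k → ones q (suc k) ≡ q ^ k + ones q k
  ones-suc zero    = refl
  ones-suc (suc k) = begin
    ones q (suc k) * q + 1        ≡⟨ cong (λ o → o * q + 1) (ones-suc k) ⟩
    (q ^ k + ones q k) * q + 1    ≡⟨ solve 3 (λ a o Q → (a :+ o) :* Q :+ con 1 := Q :* a :+ (o :* Q :+ con 1))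
                                           refl (q ^ k) (ones q k) q ⟩
    q ^ suc k + ones q (suc k)    ∎
    where open ≡-Reasoning

  ones-+ : ∀ k j → ones q (k + j) ≡ ones q k * q ^ j + ones q j
  ones-+ k zero    = begin
    ones q (k + 0)        ≡⟨ cong (ones q) (+-identityʳ k) ⟩
    ones q k              ≡⟨ solve 1 (λ o → o := o :* con 1 :+ con 0) refl (ones q k) ⟩
    ones q k * 1 + 0      ∎
    where open ≡-Reasoning
  ones-+ k (suc j) = begin
    ones q (k + suc j)                       ≡⟨ cong (ones q) (+-suc k j) ⟩
    ones q (k + j) * q + 1                   ≡⟨ cong (λ o → o * q + 1) (ones-+ k j) ⟩
    (ones q k * q ^ j + ones q j) * q + 1    ≡⟨ solve 4 (λ o Z w Q → (o :* Z :+ w) :* Q :+ con 1 := o :* (Q :* Z) :+ (w :* Q :+ con 1))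
                                                      refl (ones q k) (q ^ j) (ones q j) q ⟩
    ones q k * q ^ suc j + ones q (suc j)    ∎
    where open ≡-Reasoning

  ones<q^ : ∀ k → ones q k < q ^ k
  ones<q^ zero    = s≤s z≤n
  ones<q^ (suc k) = begin
    suc (ones q k * q + 1)   ≡⟨ solve 2 (λ o Q → con 1 :+ (o :* Q :+ con 1) := o :* Q :+ con 2) refl (ones q k) q ⟩
    ones q k * q + 2         ≤⟨ +-monoʳ-≤ (ones q k * q) 2≤q ⟩
    ones q k * q + q         ≡⟨ +-comm (ones q k * q) q ⟩
    suc (ones q k) * q       ≤⟨ *-monoˡ-≤ q (ones<q^ k) ⟩
    q ^ k * q                ≡⟨ *-comm (q ^ k) q ⟩
    q ^ suc k                ∎
    where open ≤-Reasoning

  q^≤ones*q : ∀ j → 1 ≤ j → q ^ j ≤ ones q j * q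
  q^≤ones*q (suc i) _ = begin
    q * q ^ i              ≡⟨ *-comm q (q ^ i) ⟩
    q ^ i * q              ≤⟨ *-monoˡ-≤ q (m≤m+n (q ^ i) (ones q i)) ⟩
    (q ^ i + ones q i) * q ≡⟨ cong (_* q) (ones-suc i) ⟨
    ones q (suc i) * q     ∎
    where open ≤-Reasoning

  below-next-power : ∀ k j t → t < q ^ j → 2 + (ones q k * q ^ suc j + t) ≤ q ^ k * q ^ suc j
  below-next-power k j t t<q^j = begin
    suc (suc (ones q k * P + t))  ≡⟨ trans (+-suc _ (suc t)) (cong suc (+-suc _ t)) ⟨
    ones q k * P + suc (suc t)    ≤⟨ +-monoʳ-≤ (ones q k * P) (s≤s t<q^j) ⟩
    ones q k * P + suc (q ^ j)    ≤⟨ +-monoʳ-≤ (ones q k * P) (^-monoʳ-< q 2≤q (n<1+n j)) ⟩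
    ones q k * P + P              ≡⟨ +-comm (ones q k * P) P ⟩
    suc (ones q k) * P            ≤⟨ *-monoˡ-≤ P (ones<q^ k) ⟩
    q ^ k * P                     ∎
    where
    open ≤-Reasoning
    P = q ^ suc j

  remainder-bound : ∀ k j t → 1 ≤ j → t < q ^ j → ones q k * q ^ suc j + suc t ≤ word q (k + j) 1
  remainder-bound k j t 1≤j t<q^j = begin
    ones q k * P + suc t                ≤⟨ +-monoʳ-≤ (ones q k * P) t<q^j ⟩
    ones q k * P + q ^ j                ≤⟨ +-monoʳ-≤ (ones q k * P) (q^≤ones*q j 1≤j) ⟩
    ones q k * P + ones q j * q         ≡⟨ solve 4 (λ o Z w Q → o :* (Q :* Z) :+ w :* Q := (o :* Z :+ w) :* (Q :* con 1))
                                                refl (ones q k) (q ^ j) (ones q j) q ⟩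
    (ones q k * q ^ j + ones q j) * q ^ 1 ≡⟨ cong (_* q ^ 1) (ones-+ k j) ⟨
    ones q (k + j) * q ^ 1              ∎
    where
    open ≤-Reasoning
    P = q ^ suc j

  carry-step : ∀ k j t → 1 ≤ j → t < q ^ j →
               Step q (ones q (suc k) * q ^ suc j + t) (ones q k * q ^ suc j + suc t)
  carry-step k j t 1≤j t<q^j =
    step-to l q∸1≤b (s≤s z≤n , L∸1≤b , b<q^suc-l∸1) b≡ (remainder-bound k j t 1≤j t<q^j)
    where
    P = q ^ suc j
    l = suc k + j
    L = q ^ l
    b = ones q (suc k) * P + t
    rest = ones q k * P + t

    L≡ : L ≡ q ^ k * P
    L≡ = trans (cong (q ^_) (sym (+-suc k j))) (^-distribˡ-+-* q k (suc j))

    b≡L+rest : b ≡ L + rest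
    b≡L+rest = begin
      ones q (suc k) * P + t        ≡⟨ cong (λ o → o * P + t) (ones-suc k) ⟩
      (q ^ k + ones q k) * P + t    ≡⟨ solve 4 (λ a o p x → (a :+ o) :* p :+ x := a :* p :+ (o :* p :+ x))
                                              refl (q ^ k) (ones q k) P t ⟩
      q ^ k * P + rest              ≡⟨ cong (_+ rest) L≡ ⟨
      L + rest                      ∎
      where open ≡-Reasoning

    b≡ : b ≡ (L ∸ 1) + (ones q k * P + suc t)
    b≡ = begin
      b                             ≡⟨ b≡L+rest ⟩
      L + rest                      ≡⟨ cong (_+ rest) (suc-pred L {{m^n≢0 q l}}) ⟨
      suc (L ∸ 1) + rest            ≡⟨ +-suc (L ∸ 1) rest ⟨
      (L ∸ 1) + suc rest            ≡⟨ cong ((L ∸ 1) +_) (+-suc (ones q k * P) t) ⟨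
      (L ∸ 1) + (ones q k * P + suc t) ∎
      where open ≡-Reasoning

    L≤b : L ≤ b
    L≤b = ≤-trans (m≤m+n L rest) (≤-reflexive (sym b≡L+rest))

    q∸1≤b : q ∸ 1 ≤ b
    q∸1≤b = ≤-trans (m∸n≤m q 1) (≤-trans (m≤m*n q (q ^ (k + j)) {{m^n≢0 q (k + j)}}) L≤b)

    L∸1≤b : L ∸ 1 ≤ b
    L∸1≤b = ≤-trans (m∸n≤m L 1) L≤b

    b<q^suc-l∸1 : b < q ^ suc l ∸ 1
    b<q^suc-l∸1 = ∸-monoˡ-≤ 1 (begin
      2 + b                         ≤⟨ below-next-power (suc k) j t t<q^j ⟩
      q ^ suc k * P                 ≡⟨ *-assoc q (q ^ k) P ⟩
      q * (q ^ k * P)               ≡⟨ cong (q *_) L≡ ⟨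
      q ^ suc l                     ∎)
      where open ≤-Reasoning

  carry-run : ∀ a j t → 1 ≤ j → t ≤ q ^ j →
              Term q (ones q (t + a) * q ^ suc j) (suc t) (ones q a * q ^ suc j + t)
  carry-run a j zero    _   _     = subst (Term q _ 1) (sym (+-identityʳ _)) first
  carry-run a j (suc t) 1≤j t<q^j = next (subst (λ i → Term q (ones q i * P) (suc t) v) (+-suc t a) run)
                                         (carry-step a j t 1≤j t<q^j)
    where
    P = q ^ suc j
    v = ones q (suc a) * P + t
    run : Term q (ones q (t + suc a) * P) (suc t) v
    run = carry-run (suc a) j t 1≤j (<⇒≤ t<q^j)

  ones*q^suc+q^≡word : ∀ a j → ones q a * q ^ suc j + q ^ j ≡ word q (a + 1) j
  ones*q^suc+q^≡word a j = begin
    ones q a * (q * q ^ j) + q ^ j   ≡⟨ solve 3 (λ o Q Z → o :* (Q :* Z) :+ Z := (o :* Q :+ con 1) :* Z) refl (ones q a) q (q ^ j) ⟩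
    ones q (suc a) * q ^ j           ≡⟨ cong (λ i → ones q i * q ^ j) (+-comm 1 a) ⟩
    ones q (a + 1) * q ^ j           ∎
    where open ≡-Reasoning

  carry-run-word : ∀ j m → 1 ≤ j → q ^ j ≤ m →
                   Term q (word q m (suc j)) (suc (q ^ j)) (word q (m ∸ q ^ j + 1) j)
  carry-run-word j m 1≤j q^j≤m =
    subst₂ (λ b v → Term q b (suc (q ^ j)) v)
      (cong (λ i → ones q i * q ^ suc j) (m+[n∸m]≡n q^j≤m))
      (ones*q^suc+q^≡word (m ∸ q ^ j) j)
      (carry-run (m ∸ q ^ j) j (q ^ j) 1≤j ≤-refl)

lemma4 : (q : ℕ) → IsPrimePower q → 2 ≤ q →
         (j m n : ℕ) → 1 ≤ j → 1 ≤ m → 1 ≤ n →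
         n ≥ q ^ j + 1 → m ≥ q ^ j →
         (Defined q (suc j) m n ⇔ Defined q j (m ∸ q ^ j + 1) (n ∸ q ^ j))
         × (∀ v w → B q (suc j) m n v → B q j (m ∸ q ^ j + 1) (n ∸ q ^ j) w → v ≡ w)
lemma4 q _ 2≤q j m n 1≤j _ _ n≥ m≥ =
  mk⇔ (map₂ (to drop)) (map₂ (from drop)) , λ _ _ t t′ → Term-deterministic (to drop t) t′
  where
  open Carry q 2≤q
  open Equivalence using (to; from)
  drop : ∀ {v} → B q (suc j) m n v ⇔ B q j (m ∸ q ^ j + 1) (n ∸ q ^ j) v
  drop = Term-drop (carry-run-word j m 1≤j m≥) (≤-trans (≤-reflexive (+-comm 1 (q ^ j))) n≥)
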